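{- Let $(\mathbf{M},\mathbf{N})$ be an $\mathrm{IMLU}$-category, with fixed terminal object $\mathbf{1}$ (of both $\mathbf{M}$ and $\mathbf{N}$) and fixed products in $\mathbf{M}$ restricting to products in $\mathbf{N}$, and let $n\in\mathbb{N}$. (a) $\iota_\mathbf{1}:\mathbf{1}\to\mathbf{T}\mathbf{1}$ is an isomorphism in $\mathbf{N}$. (b) For any objects $A,B$ of $\mathbf{N}$, $(\iota_A\times\iota_B)\circ\iota_{A\times B}^{ -1}:\mathbf{T}(A\times B)\to\mathbf{T}A\times\mathbf{T}B$ is an isomorphism in $\mathbf{N}$. (c) For any objects $A_1,\dots,A_n$ of $\mathbf{N}$, $(\iota_{A_1}\times\dots\times\iota_{A_n})\circ\iota_{A_1\times\dots\times A_n}^{ -1}:\mathbf{T}(A_1\times\dots\times A_n)\to\mathbf{T}A_1\times\dots\times\mathbf{T}A_n$ is an isomorphism in $\mathbf{N}$.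
   Context: Heyting category: finite limits, images, covers stable under pullback, each subobject poset a join-semilattice, each pullback map $f^*$ preserving finite joins with adjoints $\exists_f\dashv f^*\dashv\forall_f$. An $\mathrm{IMLU}$-category is a pair $(\mathbf{M},\mathbf{N})$ of Heyting categories with $\mathbf{N}$ a conservative (isomorphism-reflecting) Heyting subcategory of $\mathbf{M}$ (inclusion preserves the Heyting structure), together with: an object $U$ of $\mathbf{N}$ such that every object of $\mathbf{N}$ has a mono in $\mathbf{N}$ into $U$; an endofunctor $\mathbf{T}$ of $\mathbf{M}$ restricting to an endofunctor of $\mathbf{N}$ and a natural isomorphism $\iota:\mathrm{id}_\mathbf{M}\to\mathbf{T}$ on $\mathbf{M}$ (components $\iota_X$ are morphisms of $\mathbf{M}$, not necessarily of $\mathbf{N}$); an endofunctor $\mathbf{P}$ of $\mathbf{N}$ such that for each object $A$ of $\mathbf{N}$ there is $m_{\subseteq^\mathbf{T}_A}:\subseteq^\mathbf{T}_A\to\mathbf{T}A\times\mathbf{P}A$ in $\mathbf{N}$, monic in $\mathbf{M}$, such that for each $r:R\to\mathbf{T}A\times B$ in $\mathbf{N}$ monic in $\mathbf{M}$ there is $\chi:B\to\mathbf{P}A$ in $\mathbf{N}$ which is the unique morphism of $\mathbf{M}$ for which $r$ is a pullback in $\mathbf{M}$ of $m_{\subseteq^\mathbf{T}_A}$ along $\mathrm{id}\times\chi$; and a natural isomorphism $\mu:\mathbf{P}\mathbf{T}\to\mathbf{T}\mathbf{P}$ on $\mathbf{N}$. -}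

module Defs where

open import Level using (Level; _⊔_) renaming (suc to lsuc)
open import Data.Product using (Σ; _×_; _,_; proj₁; proj₂)
open import Data.Nat using (ℕ; zero; suc)
open import Data.Fin using (Fin; zero; suc)
open import Function.Bundles using (_⇔_)
open import Relation.Binary using (Rel; IsEquivalence)

record Category (o ℓ e : Level) : Set (lsuc (o ⊔ ℓ ⊔ e)) where
  infix  4 _≈_ _⇒_
  infixr 9 _∘_
  field
    Obj       : Set o
    _⇒_       : Obj → Obj → Set ℓ
    _≈_       : ∀ {A B} → Rel (A ⇒ B) e
    id        : ∀ {A} → A ⇒ A
    _∘_       : ∀ {A B C} → B ⇒ C → A ⇒ B → A ⇒ C
    ≈-equiv   : ∀ {A B} → IsEquivalence (_≈_ {A} {B})
    assoc     : ∀ {A B C D} {f : A ⇒ B} {g : B ⇒ C} {h : C ⇒ D} →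
                (h ∘ g) ∘ f ≈ h ∘ (g ∘ f)
    identityˡ : ∀ {A B} {f : A ⇒ B} → id ∘ f ≈ f
    identityʳ : ∀ {A B} {f : A ⇒ B} → f ∘ id ≈ f
    ∘-resp-≈  : ∀ {A B C} {f h : B ⇒ C} {g i : A ⇒ B} →
                f ≈ h → g ≈ i → f ∘ g ≈ h ∘ i

module CatDefs {o ℓ e} (C : Category o ℓ e) where
  open Category C

  Mono : ∀ {A B} → A ⇒ B → Set (o ⊔ ℓ ⊔ e)
  Mono {A} f = ∀ {X} (g h : X ⇒ A) → f ∘ g ≈ f ∘ h → g ≈ h

  IsInverse : ∀ {A B} → A ⇒ B → B ⇒ A → Set e
  IsInverse f g = (g ∘ f ≈ id) × (f ∘ g ≈ id)

  IsIso : ∀ {A B} → A ⇒ B → Set (ℓ ⊔ e)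
  IsIso {A} {B} f = Σ (B ⇒ A) (IsInverse f)

  IsTerminal : Obj → Set (o ⊔ ℓ ⊔ e)
  IsTerminal T = ∀ X → Σ (X ⇒ T) λ t → ∀ (f : X ⇒ T) → f ≈ t

  record IsPullback {P A B D : Obj} (f : A ⇒ D) (g : B ⇒ D)
                    (p₁ : P ⇒ A) (p₂ : P ⇒ B) : Set (o ⊔ ℓ ⊔ e) where
    field
      commute   : f ∘ p₁ ≈ g ∘ p₂
      universal : ∀ {X} (h₁ : X ⇒ A) (h₂ : X ⇒ B) → f ∘ h₁ ≈ g ∘ h₂ →
                  Σ (X ⇒ P) λ u → (p₁ ∘ u ≈ h₁) × (p₂ ∘ u ≈ h₂) ×
                    (∀ (v : X ⇒ P) → p₁ ∘ v ≈ h₁ → p₂ ∘ v ≈ h₂ → v ≈ u)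

  -- Subobjects (represented by monomorphisms), preordered by factorisation
  record Sub (A : Obj) : Set (o ⊔ ℓ ⊔ e) where
    constructor sub
    field
      {dom} : Obj
      arr   : dom ⇒ A
      mono  : Mono arr

  open Sub

  infix 4 _≤ₛ_
  _≤ₛ_ : ∀ {A} → Sub A → Sub A → Set (ℓ ⊔ e)
  m ≤ₛ n = Σ (dom m ⇒ dom n) λ k → arr n ∘ k ≈ arr m

  FactorsThrough : ∀ {X A} → X ⇒ A → Sub A → Set (ℓ ⊔ e)
  FactorsThrough {X} f m = Σ (X ⇒ dom m) λ k → arr m ∘ k ≈ f

  IsImage : ∀ {X A} → X ⇒ A → Sub A → Set (o ⊔ ℓ ⊔ e)
  IsImage f m = FactorsThrough f m × (∀ n → FactorsThrough f n → m ≤ₛ n)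

  IsCover : ∀ {X A} → X ⇒ A → Set (o ⊔ ℓ ⊔ e)
  IsCover {X} {A} f = ∀ (m : Sub A) → FactorsThrough f m → IsIso (arr m)

  IsPullbackOf : ∀ {A B} → A ⇒ B → Sub B → Sub A → Set (o ⊔ ℓ ⊔ e)
  IsPullbackOf f m n = Σ (dom n ⇒ dom m) λ k → IsPullback (arr m) f k (arr n)

  IsLeast : ∀ {A} → Sub A → Set (o ⊔ ℓ ⊔ e)
  IsLeast m = ∀ n → m ≤ₛ n

  IsJoin : ∀ {A} → Sub A → Sub A → Sub A → Set (o ⊔ ℓ ⊔ e)
  IsJoin m n j = (m ≤ₛ j) × (n ≤ₛ j) × (∀ k → m ≤ₛ k → n ≤ₛ k → j ≤ₛ k)

  IsExists : ∀ {A B} → A ⇒ B → Sub A → Sub B → Set (o ⊔ ℓ ⊔ e)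
  IsExists f m x = ∀ n n' → IsPullbackOf f n n' → (x ≤ₛ n) ⇔ (m ≤ₛ n')

  IsForall : ∀ {A B} → A ⇒ B → Sub A → Sub B → Set (o ⊔ ℓ ⊔ e)
  IsForall f m a = ∀ n n' → IsPullbackOf f n n' → (n' ≤ₛ m) ⇔ (n ≤ₛ a)

  record IsHeyting : Set (o ⊔ ℓ ⊔ e) where
    field
      terminal        : Σ Obj IsTerminal
      pullback        : ∀ {A B D} (f : A ⇒ D) (g : B ⇒ D) →
                        Σ Obj λ P → Σ (P ⇒ A) λ p₁ → Σ (P ⇒ B) λ p₂ →
                          IsPullback f g p₁ p₂
      image           : ∀ {A B} (f : A ⇒ B) → Σ (Sub B) (IsImage f)
      cover-stable    : ∀ {P A B D} {f : A ⇒ D} {g : B ⇒ D} {p₁ : P ⇒ A} {p₂ : P ⇒ B} →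
                        IsPullback f g p₁ p₂ → IsCover f → IsCover p₂
      bottom          : ∀ A → Σ (Sub A) IsLeast
      join            : ∀ {A} (m n : Sub A) → Σ (Sub A) (IsJoin m n)
      pullback-bottom : ∀ {A B} (f : A ⇒ B) {b : Sub B} {b' : Sub A} →
                        IsLeast b → IsPullbackOf f b b' → IsLeast b'
      pullback-join   : ∀ {A B} (f : A ⇒ B) {m n j : Sub B} {m' n' j' : Sub A} →
                        IsJoin m n j → IsPullbackOf f m m' → IsPullbackOf f n n' →
                        IsPullbackOf f j j' → IsJoin m' n' j'
      exists          : ∀ {A B} (f : A ⇒ B) (m : Sub A) → Σ (Sub B) (IsExists f m)
      for-all         : ∀ {A B} (f : A ⇒ B) (m : Sub A) → Σ (Sub B) (IsForall f m)

  record Terminal : Set (o ⊔ ℓ ⊔ e) where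
    field
      ⊤        : Obj
      !        : ∀ {A} → A ⇒ ⊤
      !-unique : ∀ {A} (f : A ⇒ ⊤) → f ≈ !

  record Products : Set (o ⊔ ℓ ⊔ e) where
    infixr 7 _×ₒ_
    field
      _×ₒ_     : Obj → Obj → Obj
      π₁       : ∀ {A B} → A ×ₒ B ⇒ A
      π₂       : ∀ {A B} → A ×ₒ B ⇒ B
      ⟨_,_⟩    : ∀ {X A B} → X ⇒ A → X ⇒ B → X ⇒ A ×ₒ B
      project₁ : ∀ {X A B} {f : X ⇒ A} {g : X ⇒ B} → π₁ ∘ ⟨ f , g ⟩ ≈ f
      project₂ : ∀ {X A B} {f : X ⇒ A} {g : X ⇒ B} → π₂ ∘ ⟨ f , g ⟩ ≈ g
      unique   : ∀ {X A B} {f : X ⇒ A} {g : X ⇒ B} {h : X ⇒ A ×ₒ B} →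
                 π₁ ∘ h ≈ f → π₂ ∘ h ≈ g → h ≈ ⟨ f , g ⟩

    infixr 8 _⁂_
    _⁂_ : ∀ {A B C D} → A ⇒ B → C ⇒ D → A ×ₒ C ⇒ B ×ₒ D
    f ⁂ g = ⟨ f ∘ π₁ , g ∘ π₂ ⟩

  module NAry (t : Terminal) (p : Products) where
    open Terminal t
    open Products p

    prodObj : (n : ℕ) → (Fin n → Obj) → Obj
    prodObj zero          A = ⊤
    prodObj (suc zero)    A = A zero
    prodObj (suc (suc n)) A = A zero ×ₒ prodObj (suc n) (λ i → A (suc i))

    prodMap : (n : ℕ) {A B : Fin n → Obj} → (∀ i → A i ⇒ B i) →
              prodObj n A ⇒ prodObj n B
    prodMap zero          f = id
    prodMap (suc zero)    f = f zero
    prodMap (suc (suc n)) f = f zero ⁂ prodMap (suc n) (λ i → f (suc i))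

record Functor {o ℓ e o' ℓ' e'} (C : Category o ℓ e) (D : Category o' ℓ' e')
       : Set (o ⊔ ℓ ⊔ e ⊔ o' ⊔ ℓ' ⊔ e') where
  private
    module C = Category C
    module D = Category D
  field
    F₀           : C.Obj → D.Obj
    F₁           : ∀ {A B} → A C.⇒ B → F₀ A D.⇒ F₀ B
    identity     : ∀ {A} → F₁ (C.id {A}) D.≈ D.id
    homomorphism : ∀ {X Y Z} {f : X C.⇒ Y} {g : Y C.⇒ Z} →
                   F₁ (g C.∘ f) D.≈ F₁ g D.∘ F₁ f
    F-resp-≈     : ∀ {A B} {f g : A C.⇒ B} → f C.≈ g → F₁ f D.≈ F₁ g

idF : ∀ {o ℓ e} {C : Category o ℓ e} → Functor C C
idF {C = C} = record
  { F₀ = λ A → A ; F₁ = λ f → f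
  ; identity = IsEquivalence.refl ≈-equiv
  ; homomorphism = IsEquivalence.refl ≈-equiv
  ; F-resp-≈ = λ p → p }
  where open Category C

infixr 9 _∘F_
_∘F_ : ∀ {o₁ ℓ₁ e₁ o₂ ℓ₂ e₂ o₃ ℓ₃ e₃}
       {C : Category o₁ ℓ₁ e₁} {D : Category o₂ ℓ₂ e₂} {E : Category o₃ ℓ₃ e₃} →
       Functor D E → Functor C D → Functor C E
_∘F_ {E = E} G F = record
  { F₀ = λ A → G.F₀ (F.F₀ A)
  ; F₁ = λ f → G.F₁ (F.F₁ f)
  ; identity = IsEquivalence.trans E.≈-equiv (G.F-resp-≈ F.identity) G.identity
  ; homomorphism = IsEquivalence.trans E.≈-equiv (G.F-resp-≈ F.homomorphism) G.homomorphism
  ; F-resp-≈ = λ p → G.F-resp-≈ (F.F-resp-≈ p) }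
  where
    module G = Functor G
    module F = Functor F
    module E = Category E

record NatIso {o ℓ e o' ℓ' e'} {C : Category o ℓ e} {D : Category o' ℓ' e'}
       (F G : Functor C D) : Set (o ⊔ ℓ ⊔ e ⊔ o' ⊔ ℓ' ⊔ e') where
  private
    module C = Category C
    module D = Category D
    module F = Functor F
    module G = Functor G
  field
    η       : ∀ X → F.F₀ X D.⇒ G.F₀ X
    η⁻¹     : ∀ X → G.F₀ X D.⇒ F.F₀ X
    iso     : ∀ X → CatDefs.IsInverse D (η X) (η⁻¹ X)
    natural : ∀ {X Y} (f : X C.⇒ Y) → η Y D.∘ F.F₁ f D.≈ G.F₁ f D.∘ η X

module _ {o ℓ e o' ℓ' e'} {C : Category o ℓ e} {D : Category o' ℓ' e'} where
  private
    module C = Category C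
    module D = Category D
    module CC = CatDefs C
    module DD = CatDefs D

  mapSub : (F : Functor C D) →
           (∀ {A B} {f : A C.⇒ B} → CC.Mono f → DD.Mono (Functor.F₁ F f)) →
           ∀ {A} → CC.Sub A → DD.Sub (Functor.F₀ F A)
  mapSub F pm m = DD.sub (Functor.F₁ F (CC.Sub.arr m)) (pm (CC.Sub.mono m))

  record IsHeytingFunctor (F : Functor C D) : Set (o ⊔ ℓ ⊔ e ⊔ o' ⊔ ℓ' ⊔ e') where
    open Functor F
    field
      preserves-terminal : ∀ {T} → CC.IsTerminal T → DD.IsTerminal (F₀ T)
      preserves-pullback : ∀ {P A B X} {f : A C.⇒ X} {g : B C.⇒ X}
                             {p₁ : P C.⇒ A} {p₂ : P C.⇒ B} →
                           CC.IsPullback f g p₁ p₂ →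
                           DD.IsPullback (F₁ f) (F₁ g) (F₁ p₁) (F₁ p₂)
      preserves-mono     : ∀ {A B} {f : A C.⇒ B} → CC.Mono f → DD.Mono (F₁ f)
      preserves-cover    : ∀ {A B} {f : A C.⇒ B} → CC.IsCover f → DD.IsCover (F₁ f)
      preserves-image    : ∀ {A B} {f : A C.⇒ B} {m : CC.Sub B} → CC.IsImage f m →
                           DD.IsImage (F₁ f) (mapSub F preserves-mono m)
      preserves-bottom   : ∀ {A} {m : CC.Sub A} → CC.IsLeast m →
                           DD.IsLeast (mapSub F preserves-mono m)
      preserves-join     : ∀ {A} {m n j : CC.Sub A} → CC.IsJoin m n j →
                           DD.IsJoin (mapSub F preserves-mono m)
                                     (mapSub F preserves-mono n)
                                     (mapSub F preserves-mono j)
      preserves-forall   : ∀ {A B} {f : A C.⇒ B} {m : CC.Sub A} {a : CC.Sub B} →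
                           CC.IsForall f m a →
                           DD.IsForall (F₁ f) (mapSub F preserves-mono m)
                                       (mapSub F preserves-mono a)

module _ {o ℓ e} (M : Category o ℓ e) where
  open Category M

  record Subcategory : Set (lsuc (o ⊔ ℓ) ⊔ e) where
    field
      N-obj  : Obj → Set o
      N-hom  : ∀ {A B} → A ⇒ B → Set ℓ
      N-id   : ∀ {A} → N-obj A → N-hom (id {A})
      N-∘    : ∀ {A B C} {f : B ⇒ C} {g : A ⇒ B} → N-hom f → N-hom g → N-hom (f ∘ g)
      N-resp : ∀ {A B} {f g : A ⇒ B} → f ≈ g → N-hom f → N-hom g

  Induced : Subcategory → Category o ℓ e
  Induced S = record
    { Obj = Σ Obj N-obj
    ; _⇒_ = λ A B → Σ (proj₁ A ⇒ proj₁ B) N-hom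
    ; _≈_ = λ f g → proj₁ f ≈ proj₁ g
    ; id = λ {A} → id , N-id (proj₂ A)
    ; _∘_ = λ f g → (proj₁ f ∘ proj₁ g) , N-∘ (proj₂ f) (proj₂ g)
    ; ≈-equiv = record { refl = IsEquivalence.refl ≈-equiv
                       ; sym = IsEquivalence.sym ≈-equiv
                       ; trans = IsEquivalence.trans ≈-equiv }
    ; assoc = assoc
    ; identityˡ = identityˡ
    ; identityʳ = identityʳ
    ; ∘-resp-≈ = ∘-resp-≈ }
    where open Subcategory S

  Inclusion : (S : Subcategory) → Functor (Induced S) M
  Inclusion S = record
    { F₀ = proj₁ ; F₁ = proj₁
    ; identity = IsEquivalence.refl ≈-equiv
    ; homomorphism = IsEquivalence.refl ≈-equiv
    ; F-resp-≈ = λ p → p }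

  Conservative : Subcategory → Set (o ⊔ ℓ ⊔ e)
  Conservative S = ∀ {A B} (f : Category._⇒_ (Induced S) A B) →
                   CatDefs.IsIso M (proj₁ f) → CatDefs.IsIso (Induced S) {A} {B} f

  IsIsoIn : (S : Subcategory) → ∀ {A B} → A ⇒ B → Set (ℓ ⊔ e)
  IsIsoIn S {A} {B} f = N-hom f × Σ (B ⇒ A) λ g → N-hom g × CatDefs.IsInverse M f g
    where open Subcategory S

  restrict : (S : Subcategory) (T : Functor M M) →
             (∀ {A} → Subcategory.N-obj S A → Subcategory.N-obj S (Functor.F₀ T A)) →
             (∀ A B (f : Category._⇒_ (Induced S) A B) →
                Subcategory.N-hom S (Functor.F₁ T (proj₁ f))) →
             Functor (Induced S) (Induced S)
  restrict S T T-obj T-hom = record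
    { F₀ = λ A → F₀ (proj₁ A) , T-obj (proj₂ A)
    ; F₁ = λ {A} {B} f → F₁ (proj₁ f) , T-hom A B f
    ; identity = identity
    ; homomorphism = homomorphism
    ; F-resp-≈ = F-resp-≈ }
    where open Functor T

  record TerminalRestricts (S : Subcategory) (t : CatDefs.Terminal M) : Set (o ⊔ ℓ) where
    open Subcategory S
    open CatDefs.Terminal t
    field
      ⊤-in-N : N-obj ⊤
      !-in-N : ∀ {A} → N-obj A → N-hom (! {A})

  record ProductsRestrict (S : Subcategory) (p : CatDefs.Products M) : Set (o ⊔ ℓ) where
    open Subcategory S
    open CatDefs.Products p
    field
      ×-in-N  : ∀ {A B} → N-obj A → N-obj B → N-obj (A ×ₒ B)
      π₁-in-N : ∀ {A B} → N-obj A → N-obj B → N-hom (π₁ {A} {B})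
      π₂-in-N : ∀ {A B} → N-obj A → N-obj B → N-hom (π₂ {A} {B})
      ⟨⟩-in-N : ∀ {X A B} {f : X ⇒ A} {g : X ⇒ B} → N-hom f → N-hom g → N-hom ⟨ f , g ⟩

  record IMLU (p : CatDefs.Products M) : Set (lsuc (o ⊔ ℓ ⊔ e)) where
    open CatDefs M
    open Products p
    field
      M-heyting    : IsHeyting
      N            : Subcategory
    private
      module NC = Category (Induced N)
      module NN = CatDefs (Induced N)
    open Subcategory N
    field
      N-heyting    : NN.IsHeyting
      incl-heyting : IsHeytingFunctor (Inclusion N)
      conservative : Conservative N
      U            : NC.Obj
      U-universal  : ∀ (A : NC.Obj) → Σ (A NC.⇒ U) (NN.Mono {A} {U})
      T            : Functor M M
      T-obj        : ∀ {A} → N-obj A → N-obj (Functor.F₀ T A)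
      T-hom        : ∀ A B (f : A NC.⇒ B) → N-hom (Functor.F₁ T (proj₁ f))
      ι            : NatIso idF T
      P            : Functor (Induced N) (Induced N)
      ⊆ᵀ           : NC.Obj → NC.Obj
      m⊆           : ∀ (A : NC.Obj) →
                     proj₁ (⊆ᵀ A) ⇒ Functor.F₀ T (proj₁ A) ×ₒ proj₁ (Functor.F₀ P A)
      m⊆-in-N      : ∀ A → N-hom (m⊆ A)
      m⊆-mono      : ∀ A → Mono (m⊆ A)
      power        : ∀ (A B R : NC.Obj)
                       (r : proj₁ R ⇒ Functor.F₀ T (proj₁ A) ×ₒ proj₁ B) →
                     N-hom r → Mono r →
                     Σ (proj₁ B ⇒ proj₁ (Functor.F₀ P A)) λ χ →
                       N-hom χ ×
                       Σ (proj₁ R ⇒ proj₁ (⊆ᵀ A)) (λ k → IsPullback (m⊆ A) (id ⁂ χ) k r) ×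
                       (∀ (χ' : proj₁ B ⇒ proj₁ (Functor.F₀ P A)) →
                          Σ (proj₁ R ⇒ proj₁ (⊆ᵀ A)) (λ k → IsPullback (m⊆ A) (id ⁂ χ') k r) →
                          χ' ≈ χ)
      μ            : NatIso (P ∘F restrict N T T-obj T-hom)
                            (restrict N T T-obj T-hom ∘F P)

module Submission where

-- For objects A₁,…,Aₙ of N write φₙ for the comparison map
--   φₙ = (ι_{A₁} × … × ι_{Aₙ}) ∘ ι⁻¹_{A₁×…×Aₙ} : T(A₁×…×Aₙ) → TA₁×…×TAₙ.
-- It is always an isomorphism of M, with inverse ι ∘ (ι⁻¹ × … × ι⁻¹), and N is
-- conservative, so φₙ is an isomorphism of N as soon as it is a morphism of N.
-- That membership is proved by induction on n:
--   * φ₀ is a map into the terminal object, hence equal to ! ;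
--   * φ₁ = ι ∘ ι⁻¹ = id ;
--   * the binary comparison map equals ⟨T π₁ , T π₂⟩ (naturality of ι), which
--     lies in N because T and the products of M restrict to N ;
--   * φₙ₊₂ factors as (id × φₙ₊₁) ∘ (binary comparison for A₁ and A₂×…×Aₙ₊₂).  Part (c) is the general statement, part (b) its
-- instance n = 2, and part (a) follows from its instance n = 0 (φ₀ = ι⁻¹_𝟏).

open import Data.Nat using (ℕ; zero; suc)
open import Data.Fin using (Fin; zero; suc)
open import Data.Product using (_×_; _,_; proj₁; proj₂)
open import Data.Vec.Functional using ([]; _∷_)
open import Relation.Binary using (Setoid; IsEquivalence)
import Relation.Binary.Reasoning.Setoid as SetoidReasoning
open import Defs

module CategoryFacts {o ℓ e} (C : Category o ℓ e) where
  open Category C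
  open CatDefs C

  hom : Obj → Obj → Setoid ℓ e
  hom A B = record { Carrier = A ⇒ B ; _≈_ = _≈_ ; isEquivalence = ≈-equiv }

  module ≈ {A B : Obj} = IsEquivalence (≈-equiv {A} {B})

  refl⟩∘⟨_ : ∀ {A B D} {f : B ⇒ D} {g g' : A ⇒ B} → g ≈ g' → f ∘ g ≈ f ∘ g'
  refl⟩∘⟨ p = ∘-resp-≈ ≈.refl p

  _⟩∘⟨refl : ∀ {A B D} {f f' : B ⇒ D} {g : A ⇒ B} → f ≈ f' → f ∘ g ≈ f' ∘ g
  p ⟩∘⟨refl = ∘-resp-≈ p ≈.refl

  paste : ∀ {A B D E F G} {q : D ⇒ E} {x : B ⇒ D} {y : A ⇒ B} {a : F ⇒ E} {r : B ⇒ F}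
            {b : G ⇒ F} {s : A ⇒ G} →
          q ∘ x ≈ a ∘ r → r ∘ y ≈ b ∘ s → q ∘ (x ∘ y) ≈ (a ∘ b) ∘ s
  paste {q = q} {x} {y} {a} {r} {b} {s} qx ry = begin
    q ∘ (x ∘ y)  ≈⟨ ≈.sym assoc ⟩
    (q ∘ x) ∘ y  ≈⟨ qx ⟩∘⟨refl ⟩
    (a ∘ r) ∘ y  ≈⟨ assoc ⟩
    a ∘ (r ∘ y)  ≈⟨ refl⟩∘⟨ ry ⟩
    a ∘ (b ∘ s)  ≈⟨ ≈.sym assoc ⟩
    (a ∘ b) ∘ s  ∎
    where open SetoidReasoning (hom _ _)

  inverse-sym : ∀ {A B} {f : A ⇒ B} {g : B ⇒ A} → IsInverse f g → IsInverse g f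
  inverse-sym (gf , fg) = fg , gf

  inverse-unique : ∀ {A B} {f : A ⇒ B} {g h : B ⇒ A} → g ∘ f ≈ id → f ∘ h ≈ id → g ≈ h
  inverse-unique {f = f} {g} {h} gf fh = begin
    g            ≈⟨ ≈.sym identityʳ ⟩
    g ∘ id       ≈⟨ refl⟩∘⟨ ≈.sym fh ⟩
    g ∘ (f ∘ h)  ≈⟨ ≈.sym assoc ⟩
    (g ∘ f) ∘ h  ≈⟨ gf ⟩∘⟨refl ⟩
    id ∘ h       ≈⟨ identityˡ ⟩
    h            ∎
    where open SetoidReasoning (hom _ _)

  inverse-∘ : ∀ {A B D} {f : B ⇒ D} {g : D ⇒ B} {a : A ⇒ B} {b : B ⇒ A} →
              IsInverse f g → IsInverse a b → IsInverse (f ∘ a) (b ∘ g)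
  inverse-∘ (gf , fg) (ba , ab) = cancel gf ba , cancel ab fg
    where
    cancel : ∀ {X Y Z} {x : Y ⇒ X} {y : Z ⇒ Y} {u : Y ⇒ Z} {v : X ⇒ Y} →
             y ∘ u ≈ id → x ∘ v ≈ id → (x ∘ y) ∘ (u ∘ v) ≈ id
    cancel {x = x} {y} {u} {v} yu xv = begin
      (x ∘ y) ∘ (u ∘ v)  ≈⟨ assoc ⟩
      x ∘ (y ∘ (u ∘ v))  ≈⟨ refl⟩∘⟨ ≈.sym assoc ⟩
      x ∘ ((y ∘ u) ∘ v)  ≈⟨ refl⟩∘⟨ (yu ⟩∘⟨refl) ⟩
      x ∘ (id ∘ v)       ≈⟨ refl⟩∘⟨ identityˡ ⟩
      x ∘ v              ≈⟨ xv ⟩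
      id                 ∎
      where open SetoidReasoning (hom _ _)

  module ProductFacts (p : Products) where
    open Products p

    ⁂-resp : ∀ {A B D E} {f f' : A ⇒ B} {g g' : D ⇒ E} →
             f ≈ f' → g ≈ g' → f ⁂ g ≈ f' ⁂ g'
    ⁂-resp pf pg = unique (≈.trans project₁ (pf ⟩∘⟨refl))
                          (≈.trans project₂ (pg ⟩∘⟨refl))

    ⁂-identity : ∀ {A B} → id {A} ⁂ id {B} ≈ id
    ⁂-identity = ≈.sym (unique (≈.trans identityʳ (≈.sym identityˡ))
                               (≈.trans identityʳ (≈.sym identityˡ)))

    ⁂-∘ : ∀ {A B D E F G} {f : B ⇒ D} {g : F ⇒ G} {h : A ⇒ B} {k : E ⇒ F} →
          (f ⁂ g) ∘ (h ⁂ k) ≈ (f ∘ h) ⁂ (g ∘ k)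
    ⁂-∘ = unique (paste project₁ project₁) (paste project₂ project₂)

    ⁂-inverse : ∀ {A B D E} {f : A ⇒ B} {g : B ⇒ A} {h : D ⇒ E} {k : E ⇒ D} →
                IsInverse f g → IsInverse h k → IsInverse (f ⁂ h) (g ⁂ k)
    ⁂-inverse (gf , fg) (kh , hk) = both gf kh , both fg hk
      where
      both : ∀ {X Y Z W} {x : X ⇒ Y} {y : Y ⇒ X} {z : Z ⇒ W} {w : W ⇒ Z} →
             x ∘ y ≈ id → z ∘ w ≈ id → (x ⁂ z) ∘ (y ⁂ w) ≈ id
      both xy zw = ≈.trans ⁂-∘ (≈.trans (⁂-resp xy zw) ⁂-identity)

  module NAryFacts (t : Terminal) (p : Products) where
    open NAry t p
    open ProductFacts p

    prodMap-inverse : ∀ n {A B : Fin n → Obj} {f : ∀ i → A i ⇒ B i} {g : ∀ i → B i ⇒ A i} →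
                      (∀ i → IsInverse (f i) (g i)) → IsInverse (prodMap n f) (prodMap n g)
    prodMap-inverse zero          inv = identityˡ , identityˡ
    prodMap-inverse (suc zero)    inv = inv zero
    prodMap-inverse (suc (suc n)) inv =
      ⁂-inverse (inv zero) (prodMap-inverse (suc n) (λ i → inv (suc i)))

module SubcategoryFacts {o ℓ e} (M : Category o ℓ e) (N : Subcategory M) where
  open Category M
  open CatDefs M
  open CategoryFacts M
  open Subcategory N

  isoIn-resp : ∀ {A B} {f f' : A ⇒ B} → f ≈ f' → IsIsoIn M N f → IsIsoIn M N f'
  isoIn-resp f≈f' (nf , g , ng , (gf , fg)) =
    N-resp f≈f' nf , g , ng , ≈.trans (refl⟩∘⟨ ≈.sym f≈f') gf , ≈.trans (≈.sym f≈f' ⟩∘⟨refl) fg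

  isoIn-inverse : ∀ {A B} {f : A ⇒ B} {g : B ⇒ A} →
                  IsIsoIn M N f → IsInverse f g → IsIsoIn M N g
  isoIn-inverse {f = f} (nf , g' , ng' , (g'f , _)) (gf , fg) =
    N-resp (inverse-unique g'f fg) ng' , f , nf , (fg , gf)

  conservative-isoIn : Conservative M N → ∀ {A B} {f : A ⇒ B} {g : B ⇒ A} →
                       N-obj A → N-obj B → N-hom f → IsInverse f g → IsIsoIn M N f
  conservative-isoIn conservative {A} {B} {f} {g} nA nB nf inv
    with conservative {A , nA} {B , nB} (f , nf) (g , inv)
  ... | (g' , ng') , inv' = nf , g' , ng' , inv'

module Comparison {o ℓ e} (M : Category o ℓ e)
                  (t : CatDefs.Terminal M) (p : CatDefs.Products M)
                  (N : Subcategory M) (conservative : Conservative M N)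
                  (tr : TerminalRestricts M N t) (pr : ProductsRestrict M N p)
                  (T : Functor M M) (ι : NatIso idF T)
                  (T-obj : ∀ {A} → Subcategory.N-obj N A → Subcategory.N-obj N (Functor.F₀ T A))
                  (T-hom : ∀ {A B} {f : Category._⇒_ M A B} →
                           Subcategory.N-obj N A → Subcategory.N-obj N B →
                           Subcategory.N-hom N f → Subcategory.N-hom N (Functor.F₁ T f))
                  where
  open Category M
  open CatDefs M
  open Terminal t
  open Products p
  open NAry t p
  open Subcategory N
  open TerminalRestricts tr
  open ProductsRestrict pr
  open Functor T using (F₀; F₁)
  open NatIso ι
  open CategoryFacts M
  open ProductFacts p
  open NAryFacts t p
  open SubcategoryFacts M N

  ⁂-in-N : ∀ {A B D E} {f : A ⇒ B} {g : D ⇒ E} →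
           N-obj A → N-obj D → N-hom f → N-hom g → N-hom (f ⁂ g)
  ⁂-in-N nA nD nf ng = ⟨⟩-in-N (N-∘ nf (π₁-in-N nA nD)) (N-∘ ng (π₂-in-N nA nD))

  prodObj-in-N : ∀ n (A : Fin n → Obj) → (∀ i → N-obj (A i)) → N-obj (prodObj n A)
  prodObj-in-N zero          A nA = ⊤-in-N
  prodObj-in-N (suc zero)    A nA = nA zero
  prodObj-in-N (suc (suc n)) A nA =
    ×-in-N (nA zero) (prodObj-in-N (suc n) (λ i → A (suc i)) (λ i → nA (suc i)))

  ι-conjugate : ∀ {A B} (q : A ⇒ B) → (η B ∘ q) ∘ η⁻¹ A ≈ F₁ q
  ι-conjugate {A} q = begin
    (η _ ∘ q) ∘ η⁻¹ A         ≈⟨ natural q ⟩∘⟨refl ⟩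
    (F₁ q ∘ η A) ∘ η⁻¹ A      ≈⟨ assoc ⟩
    F₁ q ∘ (η A ∘ η⁻¹ A)      ≈⟨ refl⟩∘⟨ proj₂ (iso A) ⟩
    F₁ q ∘ id                 ≈⟨ identityʳ ⟩
    F₁ q                      ∎
    where open SetoidReasoning (hom _ _)

  ι⁻¹-cancel : ∀ {A B} (f : A ⇒ B) → (f ∘ η⁻¹ A) ∘ η A ≈ f
  ι⁻¹-cancel {A} f = ≈.trans assoc (≈.trans (refl⟩∘⟨ proj₁ (iso A)) identityʳ)

  binary : ∀ A B → F₀ (A ×ₒ B) ⇒ F₀ A ×ₒ F₀ B
  binary A B = (η A ⁂ η B) ∘ η⁻¹ (A ×ₒ B)

  binary-pairing : ∀ A B → binary A B ≈ ⟨ F₁ π₁ , F₁ π₂ ⟩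
  binary-pairing A B = unique (component project₁) (component project₂)
    where
    component : ∀ {D} {π : A ×ₒ B ⇒ D} {π' : F₀ A ×ₒ F₀ B ⇒ F₀ D} →
                π' ∘ (η A ⁂ η B) ≈ η D ∘ π → π' ∘ binary A B ≈ F₁ π
    component {π = π} {π'} square = begin
      π' ∘ ((η A ⁂ η B) ∘ η⁻¹ _)   ≈⟨ ≈.sym assoc ⟩
      (π' ∘ (η A ⁂ η B)) ∘ η⁻¹ _   ≈⟨ square ⟩∘⟨refl ⟩
      (η _ ∘ π) ∘ η⁻¹ _            ≈⟨ ι-conjugate π ⟩
      F₁ π                         ∎
      where open SetoidReasoning (hom _ _)

  binary-in-N : ∀ {A B} → N-obj A → N-obj B → N-hom (binary A B)
  binary-in-N nA nB = N-resp (≈.sym (binary-pairing _ _))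
    (⟨⟩-in-N (T-hom (×-in-N nA nB) nA (π₁-in-N nA nB))
             (T-hom (×-in-N nA nB) nB (π₂-in-N nA nB)))

  comparison : ∀ n (A : Fin n → Obj) → F₀ (prodObj n A) ⇒ prodObj n (λ i → F₀ (A i))
  comparison n A = prodMap n (λ i → η (A i)) ∘ η⁻¹ (prodObj n A)

  comparison-inverse : ∀ n (A : Fin n → Obj) →
                       IsInverse (comparison n A) (η (prodObj n A) ∘ prodMap n (λ i → η⁻¹ (A i)))
  comparison-inverse n A =
    inverse-∘ (prodMap-inverse n (λ i → iso (A i))) (inverse-sym (iso (prodObj n A)))

  comparison-split : ∀ n (A : Fin (suc (suc n)) → Obj) →
                     let A' = λ i → A (suc i) in
                     (id ⁂ comparison (suc n) A') ∘ binary (A zero) (prodObj (suc n) A')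
                       ≈ comparison (suc (suc n)) A
  comparison-split n A = begin
    (id ⁂ comparison (suc n) A') ∘ ((η (A zero) ⁂ η P) ∘ η⁻¹ _)
      ≈⟨ ≈.sym assoc ⟩
    ((id ⁂ comparison (suc n) A') ∘ (η (A zero) ⁂ η P)) ∘ η⁻¹ _
      ≈⟨ ⁂-∘ ⟩∘⟨refl ⟩
    ((id ∘ η (A zero)) ⁂ (comparison (suc n) A' ∘ η P)) ∘ η⁻¹ _
      ≈⟨ ⁂-resp identityˡ (ι⁻¹-cancel _) ⟩∘⟨refl ⟩
    comparison (suc (suc n)) A
      ∎
    where
    open SetoidReasoning (hom _ _)
    A' : Fin (suc n) → Obj
    A' i = A (suc i)
    P : Obj
    P = prodObj (suc n) A'

  comparison-in-N : ∀ n (A : Fin n → Obj) → (∀ i → N-obj (A i)) → N-hom (comparison n A)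
  comparison-in-N zero          A nA = N-resp (≈.sym (!-unique _)) (!-in-N (T-obj ⊤-in-N))
  comparison-in-N (suc zero)    A nA =
    N-resp (≈.sym (proj₂ (iso (A zero)))) (N-id (T-obj (nA zero)))
  comparison-in-N (suc (suc n)) A nA = N-resp (comparison-split n A)
    (N-∘ (⁂-in-N (T-obj (nA zero)) (T-obj nP) (N-id (T-obj (nA zero)))
                 (comparison-in-N (suc n) A' nA'))
         (binary-in-N (nA zero) nP))
    where
    A' : Fin (suc n) → Obj
    A' i = A (suc i)
    nA' : ∀ i → N-obj (A' i)
    nA' i = nA (suc i)
    nP : N-obj (prodObj (suc n) A')
    nP = prodObj-in-N (suc n) A' nA'

  comparison-isoIn : ∀ n (A : Fin n → Obj) → (∀ i → N-obj (A i)) →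
                     IsIsoIn M N (comparison n A)
  -- (conservativity is eta-expanded so that its implicit objects are not instantiated early)
  comparison-isoIn n A nA =
    conservative-isoIn (λ {A} {B} → conservative {A} {B}) (T-obj (prodObj-in-N n A nA))
      (prodObj-in-N n (λ i → F₀ (A i)) (λ i → T-obj (nA i)))
      (comparison-in-N n A nA) (comparison-inverse n A)

  binary-isoIn : ∀ A B → N-obj A → N-obj B → IsIsoIn M N (binary A B)
  binary-isoIn A B nA nB = comparison-isoIn 2 (A ∷ B ∷ []) in-N
    where
    in-N : ∀ i → N-obj ((A ∷ B ∷ []) i)
    in-N zero       = nA
    in-N (suc zero) = nB

  -- part (a): φ₀ = id ∘ ι⁻¹_𝟏, so ι⁻¹_𝟏 and hence its inverse ι_𝟏 are N-isomorphisms
  unit-isoIn : IsIsoIn M N (η ⊤)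
  unit-isoIn = isoIn-inverse (isoIn-resp identityˡ (comparison-isoIn 0 (λ ()) (λ ())))
                             (inverse-sym (iso ⊤))

mainTheorem17 : ∀ {o ℓ e} (M : Category o ℓ e) (t : CatDefs.Terminal M) (p : CatDefs.Products M)
                  (X : IMLU M p) →
                  TerminalRestricts M (IMLU.N X) t → ProductsRestrict M (IMLU.N X) p →
                  (n : ℕ) →
                  let open Category M
                      open CatDefs M
                      open Terminal t
                      open Products p
                      open NAry t p
                      open Subcategory (IMLU.N X)
                      open NatIso (IMLU.ι X)
                  in
                  IsIsoIn M (IMLU.N X) (η ⊤)
                  × (∀ A B → N-obj A → N-obj B →
                       IsIsoIn M (IMLU.N X) ((η A ⁂ η B) ∘ η⁻¹ (A ×ₒ B)))
                  × (∀ (A : Fin n → Obj) → (∀ i → N-obj (A i)) →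
                       IsIsoIn M (IMLU.N X) (prodMap n (λ i → η (A i)) ∘ η⁻¹ (prodObj n A)))
mainTheorem17 M t p X tr pr n =
  unit-isoIn , binary-isoIn , comparison-isoIn n
  where
  open IMLU X using (N; conservative; T; ι; T-obj)
  open Comparison M t p N (λ {A} {B} → conservative {A} {B}) tr pr T ι T-obj
    (λ nA nB nf → IMLU.T-hom X (_ , nA) (_ , nB) (_ , nf))
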